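{- Let $t$ be a term and $A$ a formula of $\mathcal{L}_1$, and let $\xi$ be an environment whose domain includes the free variables of $t$ and $A$ and such that $\xi(x)$ is strongly convergent for every such variable $x$. Then $[\![t]\!]_\xi\in\mathcal{S}\mathbb{N}$ and $[\![A]\!]_\xi\in\mathcal{S}\mathrm{Bool}$ are strongly convergent.
   Context: $\mathcal{L}_0$: quantifier-free language of primitive recursive arithmetic (variables, $0$, $\mathsf{succ}$, a function symbol for each primitive recursive function, a predicate symbol for each syntactic definition of a primitive recursive predicate, $=$, connectives $\neg,\wedge,\vee,\rightarrow$). $\mathcal{L}_1$ adds, for each $(k+1)$-ary predicate symbol $P$, a $k$-ary function symbol $\varphi_P$ and a $k$-ary predicate symbol $\chi_P$. A state is a finite set $s$ of triples $\langle P,\vec m,n\rangle$ ($\vec m\in\mathbb{N}^k$, $P$ of arity $k+1$) such that $P(\vec m,n)$ holds in the standard model and $\langle P,\vec m,n\rangle,\langle P,\vec m,n'\rangle\in s$ implies $n=n'$; $\mathbb{S}$ is the set of states ordered by inclusion. $\mathcal{S}X=\{\text{functions }\mathbb{S}\to X\}$. $[\![\chi_P]\!](\vec m,s)=\mathsf{true}$ iff some $\langle P,\vec m,n\rangle\in s$; $[\![\varphi_P]\!](\vec m,s)=n$ if $\langle P,\vec m,n\rangle\in s$, else $0$. An environment is $\xi:\mathrm{Var}\to\mathcal{S}\mathbb{N}$; $[\![x]\!]_\xi=\xi(x)$, $[\![0]\!]_\xi=\lambda s.0$, $[\![f(\vec t)]\!]_\xi(s)=f([\![\vec t]\!]_\xi(s))$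 and $[\![Q(\vec t)]\!]_\xi(s)=Q([\![\vec t]\!]_\xi(s))$ for symbols of $\mathcal{L}_0$ with standard meanings $f,Q$, $[\![\varphi_P(\vec t)]\!]_\xi(s)=[\![\varphi_P]\!]([\![\vec t]\!]_\xi(s),s)$, $[\![\chi_P(\vec t)]\!]_\xi(s)=[\![\chi_P]\!]([\![\vec t]\!]_\xi(s),s)$, connectives pointwise boolean. A weakly increasing sequence is $\sigma:\mathbb{N}\to\mathbb{S}$ with $\sigma(i)\subseteq\sigma(j)$ for $i\le j$; $\alpha\in\mathcal{S}X$ is strongly convergent if for every weakly increasing $\sigma$ the sequence $(\alpha(\sigma(i)))_i$ is eventually constant. -}

module Defs where

open import Data.Nat using (ℕ; zero; suc; _≤_)
import Data.Nat as N
open import Data.Fin using (Fin)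
import Data.Fin as F
open import Data.Vec using (Vec; []; _∷_; _∷ʳ_; lookup)
import Data.Vec.Properties as VP
open import Data.List using (List; []; _∷_; _++_)
open import Data.List.Membership.Propositional using (_∈_)
open import Data.Bool using (Bool; true; false; not; _∧_; _∨_)
open import Data.Maybe using (Maybe; just; nothing; is-just)
open import Data.Product using (Σ; ∃; _×_; _,_; proj₁)
open import Relation.Nullary using (Dec; yes; no; ¬_)
open import Relation.Binary.PropositionalEquality using (_≡_; refl)
open import Relation.Binary.Definitions using (DecidableEquality)

data PR : ℕ → Set where
  zer  : PR 0
  sc   : PR 1
  proj : ∀ {n} → Fin n → PR n
  comp : ∀ {n m} → PR m → Vec (PR n) m → PR n
  rec  : ∀ {n} → PR n → PR (suc (suc n)) → PR (suc n)

mutual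
  eval : ∀ {n} → PR n → Vec ℕ n → ℕ
  eval zer [] = 0
  eval sc (x ∷ []) = suc x
  eval (proj i) xs = lookup xs i
  eval (comp f gs) xs = eval f (evalVec gs xs)
  eval (rec g h) (y ∷ xs) = evalRec g h y xs

  evalRec : ∀ {n} → PR n → PR (suc (suc n)) → ℕ → Vec ℕ n → ℕ
  evalRec g h zero xs = eval g xs
  evalRec g h (suc y) xs = eval h (y ∷ evalRec g h y xs ∷ xs)

  evalVec : ∀ {n m} → Vec (PR n) m → Vec ℕ n → Vec ℕ m
  evalVec [] xs = []
  evalVec (g ∷ gs) xs = eval g xs ∷ evalVec gs xs

-- A predicate symbol of arity k is a (syntactic) primitive recursive
-- definition of its characteristic function; it holds iff the value is
-- nonzero.
holdsᵇ : ∀ {k} → PR k → Vec ℕ k → Bool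
holdsᵇ P xs = not (eval P xs N.≡ᵇ 0)

mutual
  _≟PR_ : ∀ {n} → DecidableEquality (PR n)
  zer ≟PR zer = yes refl
  zer ≟PR proj ()
  zer ≟PR comp _ _ = no λ ()
  sc ≟PR sc = yes refl
  sc ≟PR proj _ = no λ ()
  sc ≟PR comp _ _ = no λ ()
  sc ≟PR rec _ _ = no λ ()
  proj () ≟PR zer
  proj _ ≟PR sc = no λ ()
  proj i ≟PR proj j with i F.≟ j
  ... | yes refl = yes refl
  ... | no i≢j = no λ { refl → i≢j refl }
  proj _ ≟PR comp _ _ = no λ ()
  proj _ ≟PR rec _ _ = no λ ()
  comp _ _ ≟PR zer = no λ ()
  comp _ _ ≟PR sc = no λ ()
  comp _ _ ≟PR proj _ = no λ ()
  comp {m = m} f gs ≟PR comp {m = m'} f' gs' with m N.≟ m'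
  ... | no m≢m' = no λ { refl → m≢m' refl }
  ... | yes refl with f ≟PR f' | gs ≟PRs gs'
  ...   | yes refl | yes refl = yes refl
  ...   | no f≢f' | _ = no λ { refl → f≢f' refl }
  ...   | yes _ | no gs≢gs' = no λ { refl → gs≢gs' refl }
  comp _ _ ≟PR rec _ _ = no λ ()
  rec _ _ ≟PR sc = no λ ()
  rec _ _ ≟PR proj _ = no λ ()
  rec _ _ ≟PR comp _ _ = no λ ()
  rec g h ≟PR rec g' h' with g ≟PR g' | h ≟PR h'
  ... | yes refl | yes refl = yes refl
  ... | no g≢g' | _ = no λ { refl → g≢g' refl }
  ... | yes _ | no h≢h' = no λ { refl → h≢h' refl }

  _≟PRs_ : ∀ {n m} → DecidableEquality (Vec (PR n) m)
  [] ≟PRs [] = yes refl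
  (f ∷ fs) ≟PRs (g ∷ gs) with f ≟PR g | fs ≟PRs gs
  ... | yes refl | yes refl = yes refl
  ... | no f≢g | _ = no λ { refl → f≢g refl }
  ... | yes _ | no fs≢gs = no λ { refl → fs≢gs refl }

record Entry : Set where
  constructor ⟨_,_,_⟩
  field
    {arity} : ℕ
    sym  : PR (suc arity)
    args : Vec ℕ arity
    val  : ℕ
open Entry public

-- A state: a finite set of triples (represented by a list) such that
-- P(m⃗,n) holds in the standard model, and which is functional.
ValidState : List Entry → Set
ValidState l =
  (∀ e → e ∈ l → holdsᵇ (sym e) (args e ∷ʳ val e) ≡ true)
  × (∀ {k} (P : PR (suc k)) (ms : Vec ℕ k) (n n' : ℕ) →
       ⟨ P , ms , n ⟩ ∈ l → ⟨ P , ms , n' ⟩ ∈ l → n ≡ n')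

State : Set
State = Σ (List Entry) ValidState

_⊆ˢ_ : State → State → Set
s ⊆ˢ s' = ∀ e → e ∈ proj₁ s → e ∈ proj₁ s'

𝒮 : Set → Set
𝒮 X = State → X

lookupEntry : ∀ {k} → PR (suc k) → Vec ℕ k → List Entry → Maybe ℕ
lookupEntry P ms [] = nothing
lookupEntry {k} P ms (⟨_,_,_⟩ {k'} P' ms' n ∷ l) with k' N.≟ k
... | no _ = lookupEntry P ms l
... | yes refl with P' ≟PR P | VP.≡-dec N._≟_ ms' ms
...   | yes _ | yes _ = just n
...   | _ | _ = lookupEntry P ms l

⟦χ⟧ : ∀ {k} → PR (suc k) → Vec ℕ k → State → Bool
⟦χ⟧ P ms s = is-just (lookupEntry P ms (proj₁ s))

⟦φ⟧ : ∀ {k} → PR (suc k) → Vec ℕ k → State → ℕ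
⟦φ⟧ P ms s with lookupEntry P ms (proj₁ s)
... | just n = n
... | nothing = 0

Var : Set
Var = ℕ

data Term : Set where
  var  : Var → Term
  zeroᵗ : Term
  succᵗ : Term → Term
  fun  : ∀ {k} → PR k → Vec Term k → Term
  φ    : ∀ {k} → PR (suc k) → Vec Term k → Term

data Formula : Set where
  pred : ∀ {k} → PR k → Vec Term k → Formula
  _≐_  : Term → Term → Formula
  χ    : ∀ {k} → PR (suc k) → Vec Term k → Formula
  ¬ᶠ_  : Formula → Formula
  _∧ᶠ_ : Formula → Formula → Formula
  _∨ᶠ_ : Formula → Formula → Formula
  _⇒ᶠ_ : Formula → Formula → Formula

mutual
  fvt : Term → List Var
  fvt (var x) = x ∷ []
  fvt zeroᵗ = []
  fvt (succᵗ t) = fvt t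
  fvt (fun f ts) = fvts ts
  fvt (φ P ts) = fvts ts

  fvts : ∀ {k} → Vec Term k → List Var
  fvts [] = []
  fvts (t ∷ ts) = fvt t ++ fvts ts

fvf : Formula → List Var
fvf (pred Q ts) = fvts ts
fvf (t ≐ u) = fvt t ++ fvt u
fvf (χ P ts) = fvts ts
fvf (¬ᶠ A) = fvf A
fvf (A ∧ᶠ B) = fvf A ++ fvf B
fvf (A ∨ᶠ B) = fvf A ++ fvf B
fvf (A ⇒ᶠ B) = fvf A ++ fvf B

Env : Set
Env = Var → 𝒮 ℕ

mutual
  ⟦_⟧ᵗ : Term → Env → 𝒮 ℕ
  ⟦ var x ⟧ᵗ ξ = ξ x
  ⟦ zeroᵗ ⟧ᵗ ξ = λ s → 0
  ⟦ succᵗ t ⟧ᵗ ξ = λ s → suc (⟦ t ⟧ᵗ ξ s)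
  ⟦ fun f ts ⟧ᵗ ξ = λ s → eval f (⟦ ts ⟧ᵗˢ ξ s)
  ⟦ φ P ts ⟧ᵗ ξ = λ s → ⟦φ⟧ P (⟦ ts ⟧ᵗˢ ξ s) s

  ⟦_⟧ᵗˢ : ∀ {k} → Vec Term k → Env → State → Vec ℕ k
  ⟦ [] ⟧ᵗˢ ξ s = []
  ⟦ t ∷ ts ⟧ᵗˢ ξ s = ⟦ t ⟧ᵗ ξ s ∷ ⟦ ts ⟧ᵗˢ ξ s

⟦_⟧ᶠ : Formula → Env → 𝒮 Bool
⟦ pred Q ts ⟧ᶠ ξ = λ s → holdsᵇ Q (⟦ ts ⟧ᵗˢ ξ s)
⟦ t ≐ u ⟧ᶠ ξ = λ s → ⟦ t ⟧ᵗ ξ s N.≡ᵇ ⟦ u ⟧ᵗ ξ s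
⟦ χ P ts ⟧ᶠ ξ = λ s → ⟦χ⟧ P (⟦ ts ⟧ᵗˢ ξ s) s
⟦ ¬ᶠ A ⟧ᶠ ξ = λ s → not (⟦ A ⟧ᶠ ξ s)
⟦ A ∧ᶠ B ⟧ᶠ ξ = λ s → ⟦ A ⟧ᶠ ξ s ∧ ⟦ B ⟧ᶠ ξ s
⟦ A ∨ᶠ B ⟧ᶠ ξ = λ s → ⟦ A ⟧ᶠ ξ s ∨ ⟦ B ⟧ᶠ ξ s
⟦ A ⇒ᶠ B ⟧ᶠ ξ = λ s → not (⟦ A ⟧ᶠ ξ s) ∨ ⟦ B ⟧ᶠ ξ s

WeaklyIncreasing : (ℕ → State) → Set
WeaklyIncreasing σ = ∀ i j → i ≤ j → σ i ⊆ˢ σ j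

EventuallyConstant : {X : Set} → (ℕ → X) → Set
EventuallyConstant a = ∃ λ N → ∀ i → N ≤ i → a i ≡ a N

StronglyConvergent : {X : Set} → 𝒮 X → Set
StronglyConvergent α =
  ∀ (σ : ℕ → State) → WeaklyIncreasing σ → EventuallyConstant (λ i → α (σ i))

module Submission where

-- Fix a weakly increasing sequence of states σ; we show by induction on
-- terms and formulas that ⟦t⟧ξ ∘ σ and ⟦A⟧ξ ∘ σ are eventually constant.
--
-- 1. Eventually constant sequences are closed under constants, pointwise
--    maps, binary maps and "diagonal" substitution i ↦ F (a i) i, where
--    each F m is eventually constant.  This handles every 𝓛₀ construct and
--    reduces φ_P(t⃗), χ_P(t⃗) to the case of fixed arguments m⃗.
-- 2. For fixed P, m⃗ the lookup of ⟨P, m⃗, _⟩ is persistent along σ: once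
--    it returns `just n` it does so forever, because states are
--    functional and σ is increasing.
-- 3. A persistent Maybe-valued sequence is eventually constant; this is
--    the one classical step (excluded middle decides whether it is ever
--    `just`).  Hence ⟦φ_P⟧ m⃗ ∘ σ and ⟦χ_P⟧ m⃗ ∘ σ are eventually constant.

open import Defs hiding (sym)
open import Level using (0ℓ)
open import Axiom.ExcludedMiddle using (ExcludedMiddle)
open import Data.Nat using (ℕ; _≤_; _⊔_; suc)
import Data.Nat as N
open import Data.Nat.Properties using (≤-trans; m≤m⊔n; m≤n⊔m)
open import Data.Bool using (not; _∧_; _∨_)
open import Data.Maybe using (Maybe; just; nothing; is-just; fromMaybe)
open import Data.Maybe.Properties using (just-injective)
open import Data.Vec using (Vec; []; _∷_)
import Data.Vec.Properties as VP
open import Data.List using (List; []; _∷_; _++_)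
open import Data.List.Membership.Propositional using (_∈_)
open import Data.List.Membership.Propositional.Properties using (∈-++⁺ˡ; ∈-++⁺ʳ)
open import Data.List.Relation.Unary.Any using (here; there)
open import Data.Product using (_×_; _,_; proj₁; proj₂; ∃)
open import Relation.Nullary using (yes; no)
open import Data.Empty using (⊥-elim)
open import Relation.Binary.PropositionalEquality
  using (_≡_; refl; sym; trans; cong; module ≡-Reasoning)

ec-agree : {X : Set} {a : ℕ → X} ((N , _) : EventuallyConstant a) →
           ∀ {i j} → N ≤ i → N ≤ j → a i ≡ a j
ec-agree (N , p) {i} {j} N≤i N≤j = trans (p i N≤i) (sym (p j N≤j))

ec-const : {X : Set} (x : X) → EventuallyConstant (λ (_ : ℕ) → x)
ec-const x = 0 , λ _ _ → refl

ec-cong : {X : Set} {a b : ℕ → X} → (∀ i → a i ≡ b i) →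
          EventuallyConstant a → EventuallyConstant b
ec-cong a≗b (N , p) =
  N , λ i N≤i → trans (sym (a≗b i)) (trans (p i N≤i) (a≗b N))

ec-map : {A X : Set} (f : A → X) {a : ℕ → A} →
         EventuallyConstant a → EventuallyConstant (λ i → f (a i))
ec-map f (N , p) = N , λ i N≤i → cong f (p i N≤i)

-- This is how a construct whose meaning depends on
-- the current state (φ_P, χ_P) is fed eventually constant arguments.
ec-diagonal : {A X : Set} {a : ℕ → A} (F : A → ℕ → X) →
              EventuallyConstant a → (∀ m → EventuallyConstant (F m)) →
              EventuallyConstant (λ i → F (a i) i)
ec-diagonal {a = a} F ec-a ec-F = N , stable
  where
  N₁ : ℕ
  N₁ = proj₁ ec-a
  ec-F₁ : EventuallyConstant (F (a N₁))
  ec-F₁ = ec-F (a N₁)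
  N : ℕ
  N = N₁ ⊔ proj₁ ec-F₁
  N₁≤N : N₁ ≤ N
  N₁≤N = m≤m⊔n N₁ (proj₁ ec-F₁)
  N₂≤N : proj₁ ec-F₁ ≤ N
  N₂≤N = m≤n⊔m N₁ (proj₁ ec-F₁)
  stable : ∀ i → N ≤ i → F (a i) i ≡ F (a N) N
  stable i N≤i = begin
    F (a i) i   ≡⟨ cong (λ m → F m i) (proj₂ ec-a i (≤-trans N₁≤N N≤i)) ⟩
    F (a N₁) i  ≡⟨ ec-agree ec-F₁ (≤-trans N₂≤N N≤i) N₂≤N ⟩
    F (a N₁) N  ≡⟨ cong (λ m → F m N) (sym (proj₂ ec-a N N₁≤N)) ⟩
    F (a N) N   ∎
    where open ≡-Reasoning

ec-map₂ : {A B X : Set} (f : A → B → X) {a : ℕ → A} {b : ℕ → B} →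
          EventuallyConstant a → EventuallyConstant b →
          EventuallyConstant (λ i → f (a i) (b i))
ec-map₂ f ec-a ec-b = ec-diagonal _ ec-a (λ m → ec-map (f m) ec-b)

-- Classically: either it is `just n` at some stage,
-- and constant from there on, or it is `nothing` everywhere.
ec-persistent : ExcludedMiddle 0ℓ → {X : Set} (a : ℕ → Maybe X) →
                (∀ {i j n} → i ≤ j → a i ≡ just n → a j ≡ just n) →
                EventuallyConstant a
ec-persistent em a persists with em {∃ λ i → ∃ λ n → a i ≡ just n}
... | yes (i₀ , n , aᵢ₀≡n) =
  i₀ , λ j i₀≤j → trans (persists i₀≤j aᵢ₀≡n) (sym aᵢ₀≡n)
... | no never-defined = 0 , λ j _ → trans (undefined j) (sym (undefined 0))
  where
  undefined : ∀ j → a j ≡ nothing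
  undefined j with a j in aⱼ≡
  ... | just n  = ⊥-elim (never-defined (j , n , aⱼ≡))
  ... | nothing = refl

lookup-sound : ∀ {k} (P : PR (suc k)) (ms : Vec ℕ k) {n : ℕ} (l : List Entry) →
               lookupEntry P ms l ≡ just n → ⟨ P , ms , n ⟩ ∈ l
lookup-sound P ms [] ()
lookup-sound {k} P ms (⟨_,_,_⟩ {k'} P' ms' n' ∷ l) found with k' N.≟ k
... | no _ = there (lookup-sound P ms l found)
... | yes refl with P' ≟PR P | VP.≡-dec N._≟_ ms' ms
...   | yes refl | yes refl = here (cong ⟨ P , ms ,_⟩ (sym (just-injective found)))
...   | yes _    | no _     = there (lookup-sound P ms l found)
...   | no _     | _        = there (lookup-sound P ms l found)

lookup-defined : ∀ {k} (P : PR (suc k)) (ms : Vec ℕ k) {n : ℕ} (l : List Entry) →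
                 ⟨ P , ms , n ⟩ ∈ l → ∃ λ n' → lookupEntry P ms l ≡ just n'
lookup-defined {k} P ms {n} (_ ∷ l) (here refl) with k N.≟ k
... | no k≢k = ⊥-elim (k≢k refl)
... | yes refl with P ≟PR P | VP.≡-dec N._≟_ ms ms
...   | yes _ | yes _     = n , refl
...   | yes _ | no ms≢ms  = ⊥-elim (ms≢ms refl)
...   | no P≢P | _        = ⊥-elim (P≢P refl)
lookup-defined {k} P ms (⟨_,_,_⟩ {k'} P' ms' n' ∷ l) (there recorded) with k' N.≟ k
... | no _ = lookup-defined P ms l recorded
... | yes refl with P' ≟PR P | VP.≡-dec N._≟_ ms' ms
...   | yes _ | yes _ = n' , refl
...   | yes _ | no _  = lookup-defined P ms l recorded
...   | no _  | _     = lookup-defined P ms l recorded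

lookup-recorded : ∀ {k} (P : PR (suc k)) (ms : Vec ℕ k) {n : ℕ} (s : State) →
                  ⟨ P , ms , n ⟩ ∈ proj₁ s → lookupEntry P ms (proj₁ s) ≡ just n
lookup-recorded P ms (l , _ , functional) recorded
  with lookup-defined P ms l recorded
... | n' , found =
  trans found (cong just (functional P ms _ _ (lookup-sound P ms l found) recorded))

lookup-mono : ∀ {k} (P : PR (suc k)) (ms : Vec ℕ k) {n : ℕ} (s s' : State) →
              s ⊆ˢ s' → lookupEntry P ms (proj₁ s) ≡ just n →
              lookupEntry P ms (proj₁ s') ≡ just n
lookup-mono P ms s s' s⊆s' found =
  lookup-recorded P ms s' (s⊆s' _ (lookup-sound P ms (proj₁ s) found))

⟦φ⟧-lookup : ∀ {k} (P : PR (suc k)) (ms : Vec ℕ k) (s : State) →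
             ⟦φ⟧ P ms s ≡ fromMaybe 0 (lookupEntry P ms (proj₁ s))
⟦φ⟧-lookup P ms s with lookupEntry P ms (proj₁ s)
... | just _  = refl
... | nothing = refl

ConvergentOn : Env → List Var → Set
ConvergentOn ξ xs = ∀ x → x ∈ xs → StronglyConvergent (ξ x)

on-++ˡ : ∀ ξ xs {ys} → ConvergentOn ξ (xs ++ ys) → ConvergentOn ξ xs
on-++ˡ ξ xs conv x x∈xs = conv x (∈-++⁺ˡ x∈xs)

on-++ʳ : ∀ ξ xs {ys} → ConvergentOn ξ (xs ++ ys) → ConvergentOn ξ ys
on-++ʳ ξ xs conv x x∈ys = conv x (∈-++⁺ʳ xs x∈ys)

module AlongSequence (em : ExcludedMiddle 0ℓ) (σ : ℕ → State)
                     (increasing : WeaklyIncreasing σ) where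

  ec-lookup : ∀ {k} (P : PR (suc k)) (ms : Vec ℕ k) →
              EventuallyConstant (λ i → lookupEntry P ms (proj₁ (σ i)))
  ec-lookup P ms = ec-persistent em _ λ {i} {j} i≤j → lookup-mono P ms (σ i) (σ j) (increasing i j i≤j)

  ec-φ : ∀ {k} (P : PR (suc k)) (ms : Vec ℕ k) → EventuallyConstant (λ i → ⟦φ⟧ P ms (σ i))
  ec-φ P ms = ec-cong (λ i → sym (⟦φ⟧-lookup P ms (σ i))) (ec-map (fromMaybe 0) (ec-lookup P ms))

  ec-χ : ∀ {k} (P : PR (suc k)) (ms : Vec ℕ k) → EventuallyConstant (λ i → ⟦χ⟧ P ms (σ i))
  ec-χ P ms = ec-map is-just (ec-lookup P ms)

  module _ (ξ : Env) where
    mutual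
      ec-term : ∀ t → ConvergentOn ξ (fvt t) → EventuallyConstant (λ i → ⟦ t ⟧ᵗ ξ (σ i))
      ec-term (var x)    conv = conv x (here refl) σ increasing
      ec-term zeroᵗ      conv = ec-const 0
      ec-term (succᵗ t)  conv = ec-map suc (ec-term t conv)
      ec-term (fun f ts) conv = ec-map (eval f) (ec-terms ts conv)
      ec-term (φ P ts)   conv = ec-diagonal (λ ms i → ⟦φ⟧ P ms (σ i)) (ec-terms ts conv) (ec-φ P)

      ec-terms : ∀ {k} (ts : Vec Term k) → ConvergentOn ξ (fvts ts) →
                 EventuallyConstant (λ i → ⟦ ts ⟧ᵗˢ ξ (σ i))
      ec-terms []       conv = ec-const []
      ec-terms (t ∷ ts) conv =
        ec-map₂ _∷_ (ec-term t (on-++ˡ ξ (fvt t) conv)) (ec-terms ts (on-++ʳ ξ (fvt t) conv))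

    ec-formula : ∀ A → ConvergentOn ξ (fvf A) → EventuallyConstant (λ i → ⟦ A ⟧ᶠ ξ (σ i))
    ec-formula (pred Q ts) conv = ec-map (holdsᵇ Q) (ec-terms ts conv)
    ec-formula (t ≐ u)     conv =
      ec-map₂ N._≡ᵇ_ (ec-term t (on-++ˡ ξ (fvt t) conv)) (ec-term u (on-++ʳ ξ (fvt t) conv))
    ec-formula (χ P ts)    conv = ec-diagonal (λ ms i → ⟦χ⟧ P ms (σ i)) (ec-terms ts conv) (ec-χ P)
    ec-formula (¬ᶠ A)      conv = ec-map not (ec-formula A conv)
    ec-formula (A ∧ᶠ B)    conv =
      ec-map₂ _∧_ (ec-formula A (on-++ˡ ξ (fvf A) conv)) (ec-formula B (on-++ʳ ξ (fvf A) conv))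
    ec-formula (A ∨ᶠ B)    conv =
      ec-map₂ _∨_ (ec-formula A (on-++ˡ ξ (fvf A) conv)) (ec-formula B (on-++ʳ ξ (fvf A) conv))
    ec-formula (A ⇒ᶠ B)    conv =
      ec-map₂ (λ a b → not a ∨ b) (ec-formula A (on-++ˡ ξ (fvf A) conv)) (ec-formula B (on-++ʳ ξ (fvf A) conv))

theorem4p14 : ExcludedMiddle 0ℓ →
    (t : Term) (A : Formula) (ξ : Env) →
    (∀ x → x ∈ fvt t ++ fvf A → StronglyConvergent (ξ x)) →
    StronglyConvergent (⟦ t ⟧ᵗ ξ) × StronglyConvergent (⟦ A ⟧ᶠ ξ)
theorem4p14 em t A ξ conv =
    (λ σ increasing → AlongSequence.ec-term em σ increasing ξ t (on-++ˡ ξ (fvt t) conv))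
  , (λ σ increasing → AlongSequence.ec-formula em σ increasing ξ A (on-++ʳ ξ (fvt t) conv))
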